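{- Let $\mathcal{V}$ be a variety with a $\mathsf{d}$-cube term ($\mathsf{d}>1$) and let $P$ be a $(1,\mathsf{d}-1)$-parallelogram term for $\mathcal{V}$. Let $\mathbf{A}_1,\dots,\mathbf{A}_n\in\mathcal{V}$ and let $\mathbf{B}$ be a $P$-subalgebra of $\mathbf{A}_1\times\dots\times\mathbf{A}_n$. If $(\gamma,\delta)$ and $(\beta,\delta)$ are forks in $\operatorname{fork}_i(B)$ witnessed by the pairs $(v,\hat v)$ and $(u,\hat u)$ of elements of $B$, respectively, then the pair $\bigl(p(p(v,\hat v,\hat u),p(v,\hat v,\hat v),v),\ p(u,v,v)\bigr)$ of elements of $B$ witnesses that $(\gamma,\beta^\gamma)\in\operatorname{fork}_i(B)$.
   Context: $[m]=\{1,\dots,m\}$. A $\mathsf{d}$-cube term for a class of algebras is a term $t$ satisfying identities $t(M)=(y,\dots,y)^T$ where $M$ is a matrix with $\mathsf{d}$ rows with entries from the variables $x,y$ and every column contains at least one $x$. A $(1,\mathsf{d}-1)$-parallelogram term is a $(\mathsf{d}+3)$-ary term $P$ satisfying $P(x,x,y,z,y,\dots,y)=y$ and, for each $j=2,\dots,\mathsf{d}$, $P(y,x,x,y,\dots,y,z,y,\dots,y)=y$ with $z$ in the $j$-th of the last $\mathsf{d}$ argument positions. Define $p(x,u,y):=P(x,u,y,x,y,\dots,y)$ and $x^y:=p(x,y,y)$. A $P$-subalgebra is a subalgebra of the reduct to the language $\{P\}$. For $B\subseteq A_1\times\dots\times A_n$ and $i\in[n]$, a pair $(\gamma,\delta)\in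 A_i^2$ is a fork in the $i$-th coordinate of $B$, witnessed by $b,\hat b\in B$, if $b|_{[i-1]}=\hat b|_{[i-1]}$, $b|_i=\gamma$ and $\hat b|_i=\delta$ (here $b|_I$ is the projection onto coordinates in $I$); $\operatorname{fork}_i(B)$ denotes the set of these forks. -}

module Defs where

open import Data.Nat using (ℕ; zero; suc; _+_; _<_)
open import Data.Fin using (Fin; zero; suc; toℕ; _≟_)
open import Data.Bool using (Bool; true; false; if_then_else_)
open import Data.Product using (Σ; ∃; ∃-syntax; _×_; _,_)
open import Relation.Nullary using (yes; no)
open import Relation.Binary.PropositionalEquality using (_≡_)

record Signature : Set₁ where
  field
    Op : Set
    ar : Op → ℕ
open Signature public

data Term (σ : Signature) (X : Set) : Set where
  var : X → Term σ X
  app : (f : Op σ) → (Fin (ar σ f) → Term σ X) → Term σ X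

record Algebra (σ : Signature) : Set₁ where
  field
    Carrier : Set
    op      : (f : Op σ) → (Fin (ar σ f) → Carrier) → Carrier
open Algebra public

eval : {σ : Signature} {X : Set} (A : Algebra σ) → Term σ X → (X → Carrier A) → Carrier A
eval A (var x)    ρ = ρ x
eval A (app f ts) ρ = op A f (λ k → eval A (ts k) ρ)

_⊨_≈_ : {σ : Signature} {X : Set} → Algebra σ → Term σ X → Term σ X → Set
A ⊨ s ≈ t = ∀ ρ → eval A s ρ ≡ eval A t ρ

-- A variety is given (Birkhoff) as the class of models of a set of identities
Theory : Signature → Set₁
Theory σ = Term σ ℕ → Term σ ℕ → Set

_∈V_ : {σ : Signature} → Algebra σ → Theory σ → Set
A ∈V E = ∀ s t → E s t → A ⊨ s ≈ t

-- d-cube term: an m-ary term t and a d×m matrix M over {x,y}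
-- (true = x, false = y), every column containing an x, such that
-- t(M) = (y,…,y)^T holds in every algebra of V(E).
IsCubeTerm : {σ : Signature} → Theory σ → (d m : ℕ) → Term σ (Fin m) → (Fin d → Fin m → Bool) → Set₁
IsCubeTerm {σ} E d m t M =
  (∀ (c : Fin m) → ∃[ r ] (M r c ≡ true)) ×
  (∀ (A : Algebra σ) → A ∈V E → ∀ (r : Fin d) (x y : Carrier A) →
     eval A t (λ c → if M r c then x else y) ≡ y)

HasCubeTerm : {σ : Signature} → Theory σ → ℕ → Set₁
HasCubeTerm {σ} E d = Σ ℕ λ m → Σ (Term σ (Fin m)) λ t → Σ (Fin d → Fin m → Bool) λ M → IsCubeTerm E d m t M

args : {C : Set} {d : ℕ} → C → C → C → (Fin d → C) → Fin (3 + d) → C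
args a b c l zero = a
args a b c l (suc zero) = b
args a b c l (suc (suc zero)) = c
args a b c l (suc (suc (suc k))) = l k

at : {C : Set} {d : ℕ} → Fin d → C → C → Fin d → C
at k z y l with l ≟ k
... | yes _ = z
... | no _  = y

first : {C : Set} {d : ℕ} → C → C → Fin d → C
first z y zero    = z
first z y (suc _) = y

-- (1,d-1)-parallelogram term: a (d+3)-ary term P with
--   P(x,x,y,z,y,…,y) = y   and, for j = 2,…,d,
--   P(y,x,x, y,…,y,z,y,…,y) = y   (z in the j-th of the last d positions;
--   0-based index k with 0 < k)
IsParallelogramTerm : {σ : Signature} → Theory σ → (d : ℕ) → Term σ (Fin (3 + d)) → Set₁
IsParallelogramTerm {σ} E d P =
  ∀ (A : Algebra σ) → A ∈V E → ∀ (x y z : Carrier A) →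
    (eval A P (args x x y (first z y)) ≡ y) ×
    (∀ (k : Fin d) → 0 < toℕ k → eval A P (args y x x (at k z y)) ≡ y)

module _ {σ : Signature} {d : ℕ} (P : Term σ (Fin (3 + d))) where

  pt : (A : Algebra σ) → Carrier A → Carrier A → Carrier A → Carrier A
  pt A x u y = eval A P (args x u y (first x y))

  pow : (A : Algebra σ) → Carrier A → Carrier A → Carrier A
  pow A x y = pt A x y y

  module _ {n : ℕ} (A : Fin n → Algebra σ) where

    Prod : Set
    Prod = (i : Fin n) → Carrier (A i)

    Pprod : (Fin (3 + d) → Prod) → Prod
    Pprod bs i = eval (A i) P (λ k → bs k i)

    pprod : Prod → Prod → Prod → Prod
    pprod x u y i = pt (A i) (x i) (u i) (y i)

    IsPSubalgebra : (Prod → Set) → Set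
    IsPSubalgebra B = ∀ (bs : Fin (3 + d) → Prod) → (∀ k → B (bs k)) → B (Pprod bs)

    -- b, b̂ ∈ B witness that (γ,δ) is a fork in the i-th coordinate of B
    -- (coordinates are 0-based: b|[i-1] are the coordinates j with toℕ j < toℕ i)
    WitnessFork : (Prod → Set) → (i : Fin n) → Carrier (A i) → Carrier (A i) → Prod → Prod → Set
    WitnessFork B i γ δ b b̂ =
      B b × B b̂ × (∀ (j : Fin n) → toℕ j < toℕ i → b j ≡ b̂ j) × (b i ≡ γ) × (b̂ i ≡ δ)

-- Only p(x,x,y) = y is needed, i.e. the first parallelogram identity with z := x. Below the fork coordinate v = v̂ and u = û, so both
-- elements collapse to p(u,v,v). At the fork coordinate û = v̂ = δ, so the first element
-- becomes p(a,a,v) = v = γ, while the second is p(β,γ,γ) = β^γ by definition.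
module Submission where

open import Defs
open import Data.Nat using (ℕ; _<_; _+_)
open import Data.Fin using (Fin; zero; suc; toℕ)
open import Data.Product using (_,_; proj₁)
open import Relation.Binary.PropositionalEquality
  using (_≡_; sym; trans; cong; cong₂; module ≡-Reasoning)

module _ {σ : Signature} {d : ℕ} (P : Term σ (Fin (3 + d))) where

  pt-xxy≡y : {E : Theory σ} → IsParallelogramTerm E d P →
    (A : Algebra σ) → A ∈V E → ∀ x y → pt P A x x y ≡ y
  pt-xxy≡y isPar A A∈V x y = proj₁ (isPar A A∈V x y x)

  pt-collapse : (A : Algebra σ) → (∀ x y → pt P A x x y ≡ y) →
    ∀ v u → pt P A (pt P A v v u) (pt P A v v v) v ≡ pt P A u v v
  pt-collapse A xxy v u = cong₂ (λ a b → pt P A a b v) (xxy v u) (xxy v v)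

  module _ {n : ℕ} (A : Fin n → Algebra σ) (B : Prod P A → Set) where

    pprod-closed : IsPSubalgebra P A B →
      ∀ x u y → B x → B u → B y → B (pprod P A x u y)
    pprod-closed closed x u y Bx Bu By = closed _ argsInB
      where
      argsInB : ∀ k → B (λ i → args (x i) (u i) (y i) (first (x i) (y i)) k)
      argsInB zero                      = Bx
      argsInB (suc zero)                = Bu
      argsInB (suc (suc zero))          = By
      argsInB (suc (suc (suc zero)))    = Bx
      argsInB (suc (suc (suc (suc _)))) = By

lemma3p3 : {σ : Signature} (E : Theory σ) (d : ℕ) → 1 < d → HasCubeTerm E d →
    (P : Term σ (Fin (3 + d))) → IsParallelogramTerm E d P →
    (n : ℕ) (A : Fin n → Algebra σ) → (∀ i → A i ∈V E) →
    (B : Prod P A → Set) → IsPSubalgebra P A B →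
    (i : Fin n) (γ δ β : Carrier (A i)) (v v̂ u û : Prod P A) →
    WitnessFork P A B i γ δ v v̂ → WitnessFork P A B i β δ u û →
    WitnessFork P A B i γ (pow P (A i) β γ)
      (pprod P A (pprod P A v v̂ û) (pprod P A v v̂ v̂) v)
      (pprod P A u v v)
lemma3p3 E d _ _ P isPar n A A∈V B closed i γ δ β v v̂ u û
  (Bv , Bv̂ , v≡v̂ , vᵢ≡γ , v̂ᵢ≡δ) (Bu , Bû , u≡û , uᵢ≡β , ûᵢ≡δ) =
  pB (pprod P A v v̂ û) (pprod P A v v̂ v̂) v (pB v v̂ û Bv Bv̂ Bû) (pB v v̂ v̂ Bv Bv̂ Bv̂) Bv ,
  pB u v v Bu Bv Bv ,
  agreeBelow ,
  atFork ,
  cong₂ (pow P (A i)) uᵢ≡β vᵢ≡γ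
  where
  pB : ∀ x y z → B x → B y → B z → B (pprod P A x y z)
  pB = pprod-closed P A B closed
  xxy : ∀ j → (x y : Carrier (A j)) → pt P (A j) x x y ≡ y
  xxy j = pt-xxy≡y P isPar (A j) (A∈V j)
  atFork : pprod P A (pprod P A v v̂ û) (pprod P A v v̂ v̂) v i ≡ γ
  atFork = begin
    pt P (A i) (pt P (A i) (v i) (v̂ i) (û i)) (pt P (A i) (v i) (v̂ i) (v̂ i)) (v i)
      ≡⟨ cong (λ w → pt P (A i) (pt P (A i) (v i) (v̂ i) w) (pt P (A i) (v i) (v̂ i) (v̂ i)) (v i))
              (trans ûᵢ≡δ (sym v̂ᵢ≡δ)) ⟩
    pt P (A i) (pt P (A i) (v i) (v̂ i) (v̂ i)) (pt P (A i) (v i) (v̂ i) (v̂ i)) (v i)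
      ≡⟨ xxy i _ (v i) ⟩
    v i
      ≡⟨ vᵢ≡γ ⟩
    γ ∎
    where open ≡-Reasoning
  agreeBelow : ∀ j → toℕ j < toℕ i →
    pprod P A (pprod P A v v̂ û) (pprod P A v v̂ v̂) v j ≡ pprod P A u v v j
  agreeBelow j j<i
    rewrite sym (v≡v̂ j j<i) | sym (u≡û j j<i) = pt-collapse P (A j) (xxy j) (v j) (u j)
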